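{- Let $m\ge2$ and $h\ge1$ be integers and $k\ge2$ an integer. Then \[\mathrm{capt}_{\zeta,k}(\mathcal{T}_m^h)\ge\frac{h}{1+\lfloor\log_m k\rfloor}.\]
   Context: The perfect $m$-ary tree $\mathcal{T}_m^h$ of height $h$ is the rooted tree with levels $0,1,\dots,h$, where level $0$ is the root, and every vertex in levels $0,\dots,h-1$ has exactly $m$ children in the next level. The localization game on a connected graph $G$ with $k$ cops: the robber, invisible to the cops, first chooses a starting vertex. In each round the cops choose a multiset of vertices $u_1,\dots,u_k$ (no adjacency restriction) and learn the distances $d(u_i,R)$ to the robber's current vertex $R$; the cops capture the robber if, from all information so far, they can determine the robber's vertex uniquely. If not captured, the robber moves to a neighbor or stays. The robber is omniscient. The localization number $\zeta(G)$ is the least number of cops guaranteeing capture (trees have $\zeta\le2$). For $k\ge\zeta(G)$, $\mathrm{capt}_{\zeta,k}(G)$ is the minimum number of rounds in which $k$ cops can guarantee capture under optimal play. -}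

module Defs where

open import Data.Nat using (ℕ; zero; suc; _+_; _*_; _∸_; _≤_; _<_)
open import Data.Fin using (Fin)
open import Data.List using (List; []; _∷_; length; _∷ʳ_)
open import Data.Vec using (Vec; map)
open import Data.Product using (Σ; ∃; _×_; _,_)
open import Data.Sum using (_⊎_)
open import Relation.Binary.PropositionalEquality using (_≡_)
open import Relation.Nullary using (Dec; yes; no)
open import Data.Fin.Properties using () renaming (_≟_ to _≟ᶠ_)

-- A vertex is the root-to-vertex path, i.e. a word over Fin m
-- (the sequence of child indices chosen from the root) of length ≤ h.

record Vertex (m h : ℕ) : Set where
  constructor vtx
  field
    word  : List (Fin m)
    bound : length word ≤ h
open Vertex public

ChildOf : ∀ {m h} → Vertex m h → Vertex m h → Set
ChildOf {m} v u = Σ (Fin m) λ c → word v ≡ word u ∷ʳ c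

Adjacent : ∀ {m h} → Vertex m h → Vertex m h → Set
Adjacent u v = ChildOf v u ⊎ ChildOf u v

Move : ∀ {m h} → Vertex m h → Vertex m h → Set
Move u v = u ≡ v ⊎ Adjacent u v

-- Length of the longest common prefix (= level of the lowest common ancestor).
lcpLen : ∀ {m} → List (Fin m) → List (Fin m) → ℕ
lcpLen [] _ = zero
lcpLen (_ ∷ _) [] = zero
lcpLen (a ∷ as) (b ∷ bs) with a ≟ᶠ b
... | yes _ = suc (lcpLen as bs)
... | no _  = zero

-- Graph distance in the tree: d(u,v) = |u| + |v| - 2 |lca(u,v)|
-- (the length of the unique u–v path).
dist : ∀ {m h} → Vertex m h → Vertex m h → ℕ
dist u v = (length (word u) + length (word v)) ∸ 2 * lcpLen (word u) (word v)

Walk : ℕ → ℕ → Set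
Walk m h = ℕ → Vertex m h

IsWalk : ∀ {m h} → Walk m h → Set
IsWalk w = ∀ i → Move (w i) (w (suc i))

Obs : ℕ → Set
Obs k = Vec ℕ k

-- A (deterministic, adaptive) cop strategy: given the list of all previous
-- observations (most recent first), choose the k probe vertices.
Strategy : ℕ → ℕ → ℕ → Set
Strategy m h k = List (Obs k) → Vec (Vertex m h) k

-- history S w i = observations of rounds 0 .. i-1 (most recent first).
history : ∀ {m h k} → Strategy m h k → Walk m h → ℕ → List (Obs k)
history S w zero = []
history S w (suc i) =
  map (λ u → dist u (w i)) (S (history S w i)) ∷ history S w i

-- The cops capture the robber in round i (0-based) against walk w if every
-- robber walk producing the same observations in rounds 0..i is at the same
-- vertex at round i, i.e. the robber's current vertex is uniquely determined.
CapturedAt : ∀ {m h k} → Strategy m h k → Walk m h → ℕ → Set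
CapturedAt {m} {h} S w i =
  (w' : Walk m h) → IsWalk w' →
  history S w' (suc i) ≡ history S w (suc i) → w' i ≡ w i

CapturesWithin : ∀ {m h k} → Strategy m h k → ℕ → Set
CapturesWithin {m} {h} S t =
  (w : Walk m h) → IsWalk w → Σ ℕ λ i → i < t × CapturedAt S w i

{-# OPTIONS --safe #-}
module Submission where

open import Defs
open import Data.Nat using (ℕ; suc; _+_; _*_; _^_; _≤_; _<_)
open import Data.Nat using (zero; _∸_; z≤n; s≤s; _≤′_; ≤′-refl; ≤′-step)
import Data.Nat.Properties as ℕ
open import Data.Fin using (Fin; remQuot; combine)
import Data.Fin.Properties as Fin
open import Data.List using (List; []; _∷_; length; _++_; replicate; take)
import Data.List.Properties as List
open import Data.Vec using (Vec; lookup) renaming ([] to []ᵛ; _∷_ to _∷ᵛ_; map to mapᵛ)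
open import Data.Product using (∃-syntax; _×_; _,_; proj₁; proj₂; uncurry)
open import Data.Empty using (⊥-elim)
open import Data.Sum using (inj₁)
open import Function using (_∘_)
open import Function.Definitions using (Injective)
open import Relation.Nullary using (¬_; Dec; yes; no)
open import Relation.Nullary.Decidable using (¬?; decidable-stable)
open import Relation.Binary.PropositionalEquality

-- A stationary robber on a leaf suffices.  Suppose that after r rounds the
-- leaves below some vertex p of level r(1+L) all give the same observations.
-- In the next round the k probes, cut off at level |p|+1+L, reach at most
-- k < m^(1+L) of the descendants of p on that level, so some descendant q is
-- missed; every probe is then equidistant from all leaves below q, which
-- therefore stay indistinguishable.  If t(1+L) < h, the vertex reached after
-- t rounds still has two leaves below it, so the robber is not located.

_≟ʷ_ : ∀ {m} (u v : List (Fin m)) → Dec (u ≡ v)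
_≟ʷ_ = List.≡-dec Fin._≟_

lcpLen-++-indep : ∀ {m} (q a r r′ : List (Fin m)) → q ≢ take (length q) a →
                  lcpLen a (q ++ r) ≡ lcpLen a (q ++ r′)
lcpLen-++-indep []      a       r r′ q≢ = ⊥-elim (q≢ refl)
lcpLen-++-indep (c ∷ q) []      r r′ q≢ = refl
lcpLen-++-indep (c ∷ q) (b ∷ a) r r′ q≢ with b Fin.≟ c
... | yes refl = cong suc (lcpLen-++-indep q a r r′ (q≢ ∘ cong (c ∷_)))
... | no _     = refl

replicate-injective : ∀ {A : Set} {n} {x y : A} → 0 < n →
                      replicate n x ≡ replicate n y → x ≡ y
replicate-injective {n = suc n} _ = List.∷-injectiveˡ

length-++-replicate-∸ : ∀ {A : Set} (xs : List A) (x : A) {n} → length xs ≤ n →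
                        length (xs ++ replicate (n ∸ length xs) x) ≡ n
length-++-replicate-∸ xs x {n} xs≤n = begin
  length (xs ++ replicate (n ∸ length xs) x)
    ≡⟨ List.length-++ xs ⟩
  length xs + length (replicate (n ∸ length xs) x)
    ≡⟨ cong (length xs +_) (List.length-replicate (n ∸ length xs)) ⟩
  length xs + (n ∸ length xs)
    ≡⟨ ℕ.m+[n∸m]≡n xs≤n ⟩
  n ∎
  where open ≡-Reasoning

digits : ∀ {m} n → Fin (m ^ n) → List (Fin m)
digits         zero    _ = []
digits {m = m} (suc n) c = uncurry (λ d c′ → d ∷ digits n c′) (remQuot {m} (m ^ n) c)

length-digits : ∀ {m} n (c : Fin (m ^ n)) → length (digits n c) ≡ n
length-digits         zero    c = refl
length-digits {m = m} (suc n) c = cong suc (length-digits n (proj₂ (remQuot {m} (m ^ n) c)))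

digits-injective : ∀ {m} n → Injective _≡_ _≡_ (digits {m} n)
digits-injective         zero    {Fin.zero} {Fin.zero} _ = refl
digits-injective {m = m} (suc n) {c} {c′} eq = begin
  c                                        ≡⟨ Fin.combine-remQuot {m} (m ^ n) c ⟨
  uncurry combine (remQuot {m} (m ^ n) c)  ≡⟨ cong₂ combine (List.∷-injectiveˡ eq)
                                                (digits-injective n (List.∷-injectiveʳ eq)) ⟩
  uncurry combine (remQuot {m} (m ^ n) c′) ≡⟨ Fin.combine-remQuot {m} (m ^ n) c′ ⟩
  c′                                       ∎
  where open ≡-Reasoning

extension-avoiding : ∀ {m k} n (p : List (Fin m)) (ws : Fin k → List (Fin m)) →
                     k < m ^ n → ∃[ s ] length s ≡ n × (∀ j → p ++ s ≢ ws j)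
extension-avoiding n p ws k<mⁿ
  with Fin.any? (λ c → ¬? (Fin.any? (λ j → (p ++ digits n c) ≟ʷ ws j)))
... | yes (c , missed) = digits n c , length-digits n c , λ j eq → missed (j , eq)
... | no none = ⊥-elim (Fin.<⇒notInjective k<mⁿ hit-injective)
  where
  hit : ∀ c → ∃[ j ] p ++ digits n c ≡ ws j
  hit c = decidable-stable (Fin.any? (λ j → (p ++ digits n c) ≟ʷ ws j))
                           (λ missed → none (c , missed))

  hit-injective : Injective _≡_ _≡_ (proj₁ ∘ hit)
  hit-injective {c} {c′} eq = digits-injective n (List.++-cancelˡ p _ _
    (trans (proj₂ (hit c)) (trans (cong ws eq) (sym (proj₂ (hit c′))))))

map-cong-lookup : ∀ {A B : Set} {n} (f g : A → B) (xs : Vec A n) →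
                  (∀ j → f (lookup xs j) ≡ g (lookup xs j)) → mapᵛ f xs ≡ mapᵛ g xs
map-cong-lookup f g []ᵛ        eq = refl
map-cong-lookup f g (x ∷ᵛ xs) eq =
  cong₂ _∷ᵛ_ (eq Fin.zero) (map-cong-lookup f g xs (eq ∘ Fin.suc))

history-≤ : ∀ {m h k} (S : Strategy m h k) {w w′ : Walk m h} {r t} → r ≤ t →
            history S w t ≡ history S w′ t → history S w r ≡ history S w′ r
history-≤ S = go ∘ ℕ.≤⇒≤′
  where
  go : ∀ {w w′ r t} → r ≤′ t →
       history S w t ≡ history S w′ t → history S w r ≡ history S w′ r
  go ≤′-refl         eq = eq
  go (≤′-step r≤′t) eq = go r≤′t (List.∷-injectiveʳ eq)

stay : ∀ {m h} → Vertex m h → Walk m h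
stay x _ = x

stay-isWalk : ∀ {m h} (x : Vertex m h) → IsWalk (stay x)
stay-isWalk x _ = inj₁ refl

capture-separates : ∀ {m h k} (S : Strategy m h k) {t} {x y : Vertex m h} →
                    CapturesWithin S t → history S (stay x) t ≡ history S (stay y) t → x ≡ y
capture-separates S {x = x} {y} captures same
  with i , i<t , captured ← captures (stay x) (stay-isWalk x)
  = sym (captured (stay y) (stay-isWalk y) (history-≤ S i<t (sym same)))

module _ {m h : ℕ} where

  record LeafBelow (p : List (Fin m)) (v : Vertex m h) : Set where
    constructor leafBelow
    field
      isLeaf  : length (word v) ≡ h
      suffix  : List (Fin m)
      extends : word v ≡ p ++ suffix

  LeafBelow-++ : ∀ p s {x} → LeafBelow (p ++ s) x → LeafBelow p x
  LeafBelow-++ p s (leafBelow len r eq) =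
    leafBelow len (s ++ r) (trans eq (List.++-assoc p s r))

  leaf : (p : List (Fin m)) → length p ≤ h → Fin m → Vertex m h
  leaf p p≤h c =
    vtx (p ++ replicate (h ∸ length p) c) (ℕ.≤-reflexive (length-++-replicate-∸ p c p≤h))

  leaf-below : ∀ p p≤h c → LeafBelow p (leaf p p≤h c)
  leaf-below p p≤h c = leafBelow (length-++-replicate-∸ p c p≤h) _ refl

  leaf-injective : ∀ p (p<h : length p < h) {a b} →
                   leaf p (ℕ.<⇒≤ p<h) a ≡ leaf p (ℕ.<⇒≤ p<h) b → a ≡ b
  leaf-injective p p<h eq =
    replicate-injective (ℕ.m<n⇒0<n∸m p<h) (List.++-cancelˡ p _ _ (cong word eq))

  leaves-equidistant : ∀ q u {x y} → q ≢ take (length q) (word u) →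
                       LeafBelow q x → LeafBelow q y → dist u x ≡ dist u y
  leaves-equidistant q u {x} {y} q≢ (leafBelow lenx rx eqx) (leafBelow leny ry eqy) =
    cong₂ (λ l c → (length (word u) + l) ∸ 2 * c) (trans lenx (sym leny)) (begin
      lcpLen (word u) (word x) ≡⟨ cong (lcpLen (word u)) eqx ⟩
      lcpLen (word u) (q ++ rx) ≡⟨ lcpLen-++-indep q (word u) rx ry q≢ ⟩
      lcpLen (word u) (q ++ ry) ≡⟨ cong (lcpLen (word u)) eqy ⟨
      lcpLen (word u) (word y) ∎)
    where open ≡-Reasoning

module Game {m h k : ℕ} (S : Strategy m h k) where

  Indistinguishable : List (Fin m) → ℕ → Set
  Indistinguishable p r = ∀ {x y} → LeafBelow p x → LeafBelow p y →
                          history S (stay x) r ≡ history S (stay y) r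

  probes : Vertex m h → ℕ → Vec (Vertex m h) k
  probes x r = S (history S (stay x) r)

  refine : ∀ n {p r x₀} → k < m ^ n → LeafBelow p x₀ → Indistinguishable p r →
           ∃[ s ] length s ≡ n × Indistinguishable (p ++ s) (suc r)
  refine n {p} {r} {x₀} k<mⁿ x₀-below same
    with s , length-s , missed ←
           extension-avoiding n p (λ j → take (length p + n) (word (lookup (probes x₀ r) j))) k<mⁿ
    = s , length-s , same′
    where
    unprobed : ∀ j → p ++ s ≢ take (length (p ++ s)) (word (lookup (probes x₀ r) j))
    unprobed j eq = missed j (trans eq (cong (λ l → take l _)
                                             (trans (List.length-++ p) (cong (length p +_) length-s))))

    same′ : Indistinguishable (p ++ s) (suc r)
    same′ {x} {y} x-below y-below = begin
      history S (stay x) (suc r)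
        ≡⟨ cong (λ H → mapᵛ (λ u → dist u x) (S H) ∷ H)
                (same (LeafBelow-++ p s x-below) x₀-below) ⟩
      mapᵛ (λ u → dist u x) (probes x₀ r) ∷ history S (stay x₀) r
        ≡⟨ cong (_∷ _) (map-cong-lookup _ _ (probes x₀ r) λ j →
             leaves-equidistant (p ++ s) (lookup (probes x₀ r) j) (unprobed j)
                                x-below y-below) ⟩
      mapᵛ (λ u → dist u y) (probes x₀ r) ∷ history S (stay x₀) r
        ≡⟨ cong (λ H → mapᵛ (λ u → dist u y) (S H) ∷ H)
                (same (LeafBelow-++ p s y-below) x₀-below) ⟨
      history S (stay y) (suc r) ∎
      where open ≡-Reasoning

  indistinguishable-prefix : ∀ n → Fin m → k < m ^ n → ∀ r → r * n ≤ h →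
                             ∃[ p ] length p ≡ r * n × Indistinguishable p r
  indistinguishable-prefix n a k<mⁿ zero _ = [] , refl , λ _ _ → refl
  indistinguishable-prefix n a k<mⁿ (suc r) r+1n≤h
    with rn≤h ← ℕ.≤-trans (ℕ.m≤n+m (r * n) n) r+1n≤h
    with p , length-p , same ← indistinguishable-prefix n a k<mⁿ r rn≤h
    with s , length-s , same′ ←
           refine n k<mⁿ (leaf-below p (ℕ.≤-trans (ℕ.≤-reflexive length-p) rn≤h) a) same
    = p ++ s
    , trans (List.length-++ p) (trans (cong₂ _+_ length-p length-s) (ℕ.+-comm (r * n) n))
    , same′

  no-capture-before : ∀ n {t} {a b : Fin m} → a ≢ b → k < m ^ n → t * n < h →
                      ¬ CapturesWithin S t
  no-capture-before n {t} {a} {b} a≢b k<mⁿ tn<h captures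
    with p , length-p , same ← indistinguishable-prefix n a k<mⁿ t (ℕ.<⇒≤ tn<h)
    = a≢b (leaf-injective p p<h (capture-separates S captures
            (same (leaf-below p (ℕ.<⇒≤ p<h) a) (leaf-below p (ℕ.<⇒≤ p<h) b))))
    where
    p<h : length p < h
    p<h = ℕ.≤-trans (s≤s (ℕ.≤-reflexive length-p)) tn<h

mainTheorem10 : (m h k : ℕ) → 2 ≤ m → 1 ≤ h → 2 ≤ k →
    (L : ℕ) → m ^ L ≤ k → k < m ^ suc L →
    (t : ℕ) (S : Strategy m h k) → CapturesWithin S t →
    h ≤ t * (1 + L)
mainTheorem10 .(suc (suc _)) h k (s≤s (s≤s z≤n)) _ _ L _ k<m^[1+L] t S captures =
  ℕ.≮⇒≥ λ t[1+L]<h →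
    Game.no-capture-before S (suc L) {a = Fin.zero} {b = Fin.suc Fin.zero} (λ ())
      k<m^[1+L] t[1+L]<h captures
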